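{- Let $\langle\mathbf{A}_{\mathrm d},\mathbf{A},\iota\rangle$ be a distributively generated (generalized) additive quantale with multiplication. An $\mathbf{A}$-module $\mathbf{Q}$ is cyclic if and only if it is isomorphic to an $\mathbf{A}$-module of the form $\mathbf{A}_\gamma$ for some structural nucleus $\gamma$ on $\mathbf{A}$.
   Context: Fix one of two parallel settings: plain ("joins" = joins of arbitrary families) or generalized ("joins" = joins of non-empty families). A (generalized) quantale is $\langle Q,\bigvee,+,\mathsf{0}\rangle$ with $Q$ a poset having all such joins, $\langle Q,+,\mathsf{0}\rangle$ a monoid with $+$ order-preserving and distributing over such joins on both sides. A (generalized) additive quantale with multiplication is a triple $\langle\mathbf{A}_{\mathrm d},\mathbf{A},\iota\rangle$: $\mathbf{A}_{\mathrm d}$ a monoid, $\mathbf{A}$ a (generalized) quantale with an additional monoid structure $\langle A,\cdot,\mathsf 1\rangle$, $\iota$ a monoid homomorphism, such that $(\bigvee_i a_i)\cdot b=\bigvee_i(a_i\cdot b)$, $(a+b)\cdot c=a\cdot c+b\cdot c$, $\mathsf0\cdot a=\mathsf0$, and for $d\in\mathbf{A}_{\mathrm d}$ left multiplication by $\iota(d)$ preserves joins, $+$, $\mathsf0$; distributively generated means $\mathbf{A}$ is generated as a (generalized) quantale by $\iota[\mathbf{A}_{\mathrm d}]$. An $\mathbf{A}$-module is a (generalized) quantale $\mathbf{Q}$ with $\ast\colon A\times Q\to Q$, order-preserving in both coordinates, with $(a\cdot b)\ast x=a\ast(b\ast x)$, $\mathsf1\ast x=x$, $(a+b)\ast x=a\ast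 x+b\ast x$, $\mathsf0\ast x=\mathsf0$, $(\bigvee_i a_i)\ast x=\bigvee_i(a_i\ast x)$, and $x\mapsto\iota(d)\ast x$ preserving $+$, $\mathsf0$, joins for $d\in\mathbf{A}_{\mathrm d}$. $\mathbf{Q}$ is cyclic if $Q=\{a\ast u:a\in A\}$ for some $u\in Q$. $\mathbf{A}$ is an $\mathbf{A}$-module via $a\ast x=a\cdot x$. A structural nucleus on a module is an order-preserving, expansive, idempotent $\gamma$ with $\gamma(x)+\gamma(y)\le\gamma(x+y)$ and $a\ast\gamma(x)\le\gamma(a\ast x)$ for all $a\in A$. $\mathbf{A}_\gamma$ is the module on $\gamma[A]$ with $\bigvee_\gamma X=\gamma(\bigvee X)$, $x+_\gamma y=\gamma(x+y)$, $\mathsf0_\gamma=\gamma(\mathsf0)$, $a\ast_\gamma x=\gamma(a\cdot x)$. -}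

module Defs where

open import Level using (0ℓ)
open import Data.Unit using (⊤)
open import Data.Product using (Σ; _,_; proj₁)
open import Relation.Binary.Core using (Rel)
open import Relation.Binary.Structures using (IsPartialOrder)
open import Algebra.Bundles using (Monoid)
open import Algebra.Structures using (IsMonoid)

-- The two parallel settings.
-- plain       : joins of arbitrary (Set-indexed) families
-- generalized : joins of non-empty families; non-emptiness of an index
--               type I is witnessed by an element of I.

data Setting : Set where
  plain generalized : Setting

Adm : Setting → Set → Set
Adm plain       I = ⊤
Adm generalized I = I

record Quantale (s : Setting) : Set₁ where
  infixl 6 _+_
  infix 4 _≈_ _≤_
  field
    Carrier        : Set
    _≈_            : Rel Carrier 0ℓ
    _≤_            : Rel Carrier 0ℓ
    isPartialOrder : IsPartialOrder _≈_ _≤_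
    ⋁              : ∀ {I : Set} → Adm s I → (I → Carrier) → Carrier
    ⋁-upper        : ∀ {I : Set} (p : Adm s I) (f : I → Carrier) (i : I) → f i ≤ ⋁ p f
    ⋁-least        : ∀ {I : Set} (p : Adm s I) (f : I → Carrier) (u : Carrier) →
                     (∀ i → f i ≤ u) → ⋁ p f ≤ u
    _+_            : Carrier → Carrier → Carrier
    0#             : Carrier
    +-isMonoid     : IsMonoid _≈_ _+_ 0#
    +-mono         : ∀ {x x′ y y′} → x ≤ x′ → y ≤ y′ → x + y ≤ x′ + y′
    +-distribˡ-⋁   : ∀ {I : Set} (p : Adm s I) (f : I → Carrier) (x : Carrier) →
                     x + ⋁ p f ≈ ⋁ p (λ i → x + f i)
    +-distribʳ-⋁   : ∀ {I : Set} (p : Adm s I) (f : I → Carrier) (x : Carrier) →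
                     ⋁ p f + x ≈ ⋁ p (λ i → f i + x)

record AQMStructure {s : Setting} (Ad : Monoid 0ℓ 0ℓ) (A : Quantale s) : Set₁ where
  open Quantale A
  private module D = Monoid Ad
  infixl 7 _·_
  field
    _·_           : Carrier → Carrier → Carrier
    1#            : Carrier
    ·-isMonoid    : IsMonoid _≈_ _·_ 1#
    ι             : D.Carrier → Carrier
    ι-cong        : ∀ {d e} → d D.≈ e → ι d ≈ ι e
    ι-∙           : ∀ d e → ι (d D.∙ e) ≈ ι d · ι e
    ι-ε           : ι D.ε ≈ 1#
    ·-distribʳ-⋁  : ∀ {I : Set} (p : Adm s I) (f : I → Carrier) (b : Carrier) →
                    ⋁ p f · b ≈ ⋁ p (λ i → f i · b)
    ·-distribʳ-+  : ∀ a b c → (a + b) · c ≈ a · c + b · c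
    ·-zeroˡ       : ∀ a → 0# · a ≈ 0#
    ι-distribˡ-⋁  : ∀ d {I : Set} (p : Adm s I) (f : I → Carrier) →
                    ι d · ⋁ p f ≈ ⋁ p (λ i → ι d · f i)
    ι-distribˡ-+  : ∀ d a b → ι d · (a + b) ≈ ι d · a + ι d · b
    ι-zeroʳ       : ∀ d → ι d · 0# ≈ 0#

record AQM (s : Setting) : Set₁ where
  field
    Ad  : Monoid 0ℓ 0ℓ
    A   : Quantale s
    str : AQMStructure Ad A
  open Quantale A public
  open AQMStructure str public
  module D = Monoid Ad

module _ {s : Setting} (M : AQM s) where
  open AQM M

  data Generated : Carrier → Set₁ where
    gen-ι : ∀ {x} d → x ≈ ι d → Generated x
    gen-⋁ : ∀ {x} {I : Set} (p : Adm s I) (f : I → Carrier) →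
            (∀ i → Generated (f i)) → x ≈ ⋁ p f → Generated x
    gen-+ : ∀ {x} a b → Generated a → Generated b → x ≈ a + b → Generated x
    gen-0 : ∀ {x} → x ≈ 0# → Generated x

  DistributivelyGenerated : Set₁
  DistributivelyGenerated = ∀ a → Generated a

  record Module : Set₁ where
    field
      Q : Quantale s
    open Quantale Q public renaming
      (Carrier to QC; _≈_ to _≈Q_; _≤_ to _≤Q_; ⋁ to ⋁Q; _+_ to _+Q_; 0# to 0Q)
    infixr 7 _*_
    field
      _*_          : Carrier → QC → QC
      *-mono       : ∀ {a a′ x x′} → a ≤ a′ → x ≤Q x′ → (a * x) ≤Q (a′ * x′)
      *-assoc      : ∀ a b x → ((a · b) * x) ≈Q (a * (b * x))
      *-identity   : ∀ x → (1# * x) ≈Q x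
      *-distribʳ-+ : ∀ a b x → ((a + b) * x) ≈Q ((a * x) +Q (b * x))
      *-zeroˡ      : ∀ x → (0# * x) ≈Q 0Q
      *-distribʳ-⋁ : ∀ {I : Set} (p : Adm s I) (f : I → Carrier) x →
                     (⋁ p f * x) ≈Q ⋁Q p (λ i → f i * x)
      ι-*-+        : ∀ d x y → (ι d * (x +Q y)) ≈Q ((ι d * x) +Q (ι d * y))
      ι-*-0        : ∀ d → (ι d * 0Q) ≈Q 0Q
      ι-*-⋁        : ∀ d {I : Set} (p : Adm s I) (f : I → QC) →
                     (ι d * ⋁Q p f) ≈Q ⋁Q p (λ i → ι d * f i)

  Cyclic : Module → Set
  Cyclic N = Σ QC (λ u → ∀ x → Σ Carrier (λ a → x ≈Q (a * u)))
    where open Module N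

  -- Structural nuclei on A (A regarded as an A-module via a ∗ x = a · x)

  record StructuralNucleus : Set where
    field
      γ          : Carrier → Carrier
      mono       : ∀ {x y} → x ≤ y → γ x ≤ γ y
      expansive  : ∀ x → x ≤ γ x
      idempotent : ∀ x → γ (γ x) ≈ γ x
      +-sub      : ∀ x y → γ x + γ y ≤ γ (x + y)
      ·-sub      : ∀ a x → a · γ x ≤ γ (a · x)

  record RawModule : Set₁ where
    field
      RC   : Set
      _≈R_ : Rel RC 0ℓ
      _≤R_ : Rel RC 0ℓ
      ⋁R   : ∀ {I : Set} → Adm s I → (I → RC) → RC
      _+R_ : RC → RC → RC
      0R   : RC
      _*R_ : Carrier → RC → RC

  forget : Module → RawModule
  forget N = record
    { RC = QC ; _≈R_ = _≈Q_ ; _≤R_ = _≤Q_ ; ⋁R = ⋁Q ; _+R_ = _+Q_ ; 0R = 0Q ; _*R_ = _*_ }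
    where open Module N

  Aγ : StructuralNucleus → RawModule
  Aγ N = record
    { RC   = Σ Carrier (λ a → Σ Carrier (λ b → a ≈ γ b))
    ; _≈R_ = λ x y → proj₁ x ≈ proj₁ y
    ; _≤R_ = λ x y → proj₁ x ≤ proj₁ y
    ; ⋁R   = λ p f → let b = ⋁ p (λ i → proj₁ (f i)) in γ b , b , refl
    ; _+R_ = λ x y → let b = proj₁ x + proj₁ y in γ b , b , refl
    ; 0R   = γ 0# , 0# , refl
    ; _*R_ = λ a x → let b = a · proj₁ x in γ b , b , refl
    }
    where
      open StructuralNucleus N
      refl : ∀ {x} → x ≈ x
      refl = IsPartialOrder.Eq.refl isPartialOrder

  record Iso (R S : RawModule) : Set₁ where
    open RawModule R
    open RawModule S renaming
      (RC to SC; _≈R_ to _≈S_; _≤R_ to _≤S_; ⋁R to ⋁S; _+R_ to _+S_; 0R to 0S; _*R_ to _*S_)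
    field
      to        : RC → SC
      from      : SC → RC
      to-cong   : ∀ {x y} → x ≈R y → to x ≈S to y
      from-cong : ∀ {x y} → x ≈S y → from x ≈R from y
      from∘to   : ∀ x → from (to x) ≈R x
      to∘from   : ∀ y → to (from y) ≈S y
      to-mono   : ∀ {x y} → x ≤R y → to x ≤S to y
      from-mono : ∀ {x y} → x ≤S y → from x ≤R from y
      to-⋁      : ∀ {I : Set} (p : Adm s I) (f : I → RC) → to (⋁R p f) ≈S ⋁S p (λ i → to (f i))
      to-+      : ∀ x y → to (x +R y) ≈S (to x +S to y)
      to-0      : to 0R ≈S 0S
      to-*      : ∀ a x → to (a *R x) ≈S (a *S to x)

-- A cyclic module Q with generator u is a quotient of A along a ↦ a ∗ u, and the
-- kernel of this quotient is recorded by the nucleus γ a = ⋁ {b | b ∗ u ≤ a ∗ u}: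
-- b ≤ γ a iff b ∗ u ≤ a ∗ u, so a ∗ u ↦ γ a identifies Q with A_γ. Conversely
-- A_γ is generated by γ 1, because γ (c · γ 1) = γ (c · 1) = γ c; this needs
-- right multiplication by c to be monotone, which holds for the elements ι d and
-- propagates through the quantale operations, hence to all of A when ι[A_d]
-- generates A.
module Submission where

open import Level using (0ℓ)
open import Data.Bool using (Bool; true; false; if_then_else_)
open import Data.Product using (Σ; _,_; proj₁; proj₂)
open import Data.Unit using (tt)
open import Function.Bundles using (_⇔_; mk⇔)
open import Relation.Binary.Bundles using (Poset)
open import Algebra.Structures using (IsMonoid)
import Relation.Binary.Reasoning.PartialOrder as PosetReasoning

open import Defs

adm : ∀ {s : Setting} {I : Set} → I → Adm s I
adm {plain}       _ = tt
adm {generalized} i = i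

module QuantaleProperties {s : Setting} (Q : Quantale s) where
  open Quantale Q

  poset : Poset 0ℓ 0ℓ 0ℓ
  poset = record { isPartialOrder = isPartialOrder }

  open Poset poset public using (module Eq; refl; reflexive; trans; antisym)
  open PosetReasoning poset

  +-cong : ∀ {x x′ y y′} → x ≈ x′ → y ≈ y′ → x + y ≈ x′ + y′
  +-cong = IsMonoid.∙-cong +-isMonoid

  ⋁-mono : ∀ {I : Set} (p : Adm s I) {f g : I → Carrier} →
           (∀ i → f i ≤ g i) → ⋁ p f ≤ ⋁ p g
  ⋁-mono p {f} {g} f≤g = ⋁-least p f _ (λ i → trans (f≤g i) (⋁-upper p g i))

  ⋁-cong : ∀ {I : Set} (p : Adm s I) {f g : I → Carrier} →
           (∀ i → f i ≈ g i) → ⋁ p f ≈ ⋁ p g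
  ⋁-cong p f≈g = antisym (⋁-mono p (λ i → reflexive (f≈g i)))
                         (⋁-mono p (λ i → reflexive (Eq.sym (f≈g i))))

  ⋁-preserving⇒mono : (h : Carrier → Carrier) → (∀ {x y} → x ≈ y → h x ≈ h y) →
    (∀ {I : Set} (p : Adm s I) (f : I → Carrier) → h (⋁ p f) ≈ ⋁ p (λ i → h (f i))) →
    ∀ {x y} → x ≤ y → h x ≤ h y
  ⋁-preserving⇒mono h h-cong h-⋁ {x} {y} x≤y = begin
    h x                     ≤⟨ ⋁-upper p (λ b → h (pair b)) false ⟩
    ⋁ p (λ b → h (pair b))  ≈⟨ h-⋁ p pair ⟨
    h (⋁ p pair)            ≈⟨ h-cong ⋁pair≈y ⟩
    h y                     ∎
    where
      pair : Bool → Carrier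
      pair b = if b then y else x
      p : Adm s Bool
      p = adm true
      pair≤y : ∀ b → pair b ≤ y
      pair≤y true  = refl
      pair≤y false = x≤y
      ⋁pair≈y : ⋁ p pair ≈ y
      ⋁pair≈y = antisym (⋁-least p pair y pair≤y) (⋁-upper p pair true)

module AQMProperties {s : Setting} (M : AQM s) where
  open AQM M
  open QuantaleProperties A
  open PosetReasoning poset

  ·-cong : ∀ {a a′ x x′} → a ≈ a′ → x ≈ x′ → a · x ≈ a′ · x′
  ·-cong = IsMonoid.∙-cong ·-isMonoid

  ι-·-monoʳ : ∀ d {x y} → x ≤ y → ι d · x ≤ ι d · y
  ι-·-monoʳ d = ⋁-preserving⇒mono (ι d ·_) (·-cong Eq.refl) (ι-distribˡ-⋁ d)

  Generated⇒·-monoʳ : ∀ {a} → Generated M a → ∀ {x y} → x ≤ y → a · x ≤ a · y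
  Generated⇒·-monoʳ {a} (gen-ι d a≈ιd) {x} {y} x≤y = begin
    a · x     ≈⟨ ·-cong a≈ιd Eq.refl ⟩
    ι d · x   ≤⟨ ι-·-monoʳ d x≤y ⟩
    ι d · y   ≈⟨ ·-cong a≈ιd Eq.refl ⟨
    a · y     ∎
  Generated⇒·-monoʳ {a} (gen-⋁ p f gen-f a≈⋁f) {x} {y} x≤y = begin
    a · x                   ≈⟨ ·-cong a≈⋁f Eq.refl ⟩
    ⋁ p f · x               ≈⟨ ·-distribʳ-⋁ p f x ⟩
    ⋁ p (λ i → f i · x)     ≤⟨ ⋁-mono p (λ i → Generated⇒·-monoʳ (gen-f i) x≤y) ⟩
    ⋁ p (λ i → f i · y)     ≈⟨ ·-distribʳ-⋁ p f y ⟨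
    ⋁ p f · y               ≈⟨ ·-cong a≈⋁f Eq.refl ⟨
    a · y                   ∎
  Generated⇒·-monoʳ {a} (gen-+ b c gen-b gen-c a≈b+c) {x} {y} x≤y = begin
    a · x             ≈⟨ ·-cong a≈b+c Eq.refl ⟩
    (b + c) · x       ≈⟨ ·-distribʳ-+ b c x ⟩
    b · x + c · x     ≤⟨ +-mono (Generated⇒·-monoʳ gen-b x≤y) (Generated⇒·-monoʳ gen-c x≤y) ⟩
    b · y + c · y     ≈⟨ ·-distribʳ-+ b c y ⟨
    (b + c) · y       ≈⟨ ·-cong a≈b+c Eq.refl ⟨
    a · y             ∎
  Generated⇒·-monoʳ {a} (gen-0 a≈0) {x} {y} _ = begin
    a · x    ≈⟨ ·-cong a≈0 Eq.refl ⟩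
    0# · x   ≈⟨ ·-zeroˡ x ⟩
    0#       ≈⟨ ·-zeroˡ y ⟨
    0# · y   ≈⟨ ·-cong a≈0 Eq.refl ⟨
    a · y    ∎

module NucleusProperties {s : Setting} {M : AQM s} (N : StructuralNucleus M) where
  open AQM M
  open QuantaleProperties A
  open StructuralNucleus N

  γ-cong : ∀ {x y} → x ≈ y → γ x ≈ γ y
  γ-cong x≈y = antisym (mono (reflexive x≈y)) (mono (reflexive (Eq.sym x≈y)))

  γ-closed : ∀ {x y} → x ≤ γ y → γ x ≤ γ y
  γ-closed {y = y} x≤γy = trans (mono x≤γy) (reflexive (idempotent y))

  γ-fixed : ∀ {c b} → c ≈ γ b → γ c ≈ c
  γ-fixed {c} {b} c≈γb = Eq.trans (γ-cong c≈γb) (Eq.trans (idempotent b) (Eq.sym c≈γb))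

  γ-absorbʳ : ∀ {a} → (∀ {x y} → x ≤ y → a · x ≤ a · y) → ∀ x → γ (a · γ x) ≈ γ (a · x)
  γ-absorbʳ {a} a·-mono x = antisym
    (γ-closed (·-sub a x))
    (γ-closed (trans (a·-mono (expansive x)) (expansive (a · γ x))))

module ModuleProperties {s : Setting} {M : AQM s} (Q : Module M) where
  open AQM M
  private module A = QuantaleProperties A
  open Module Q hiding (Q)
  open QuantaleProperties (Module.Q Q) public

  *-congˡ : ∀ {a b x} → a ≈ b → a * x ≈Q b * x
  *-congˡ a≈b = antisym (*-mono (A.reflexive a≈b) refl) (*-mono (A.reflexive (A.Eq.sym a≈b)) refl)

  *-congʳ : ∀ {a x y} → x ≈Q y → a * x ≈Q a * y
  *-congʳ x≈y = antisym (*-mono A.refl (reflexive x≈y)) (*-mono A.refl (reflexive (Eq.sym x≈y)))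

module GeneratorNucleus {s : Setting} {M : AQM s} (Q : Module M) (u : Module.QC Q) where
  open AQM M using (A; Carrier; _≈_; _≤_; ⋁; _+_; _·_)
  private module A = QuantaleProperties A
  open Module Q hiding (Q)
  open ModuleProperties Q
  open PosetReasoning poset

  Below : Carrier → Set
  Below a = Σ Carrier (λ b → b * u ≤Q a * u)

  -- a itself witnesses that Below a is non-empty, as the generalized setting requires.
  γ : Carrier → Carrier
  γ a = ⋁ (adm {I = Below a} (a , refl)) proj₁

  γ-greatest : ∀ {a b} → b * u ≤Q a * u → b ≤ γ a
  γ-greatest {a} {b} b*u≤a*u = Quantale.⋁-upper A (adm (a , refl)) proj₁ (b , b*u≤a*u)

  γ-*-≤ : ∀ a → γ a * u ≤Q a * u
  γ-*-≤ a = begin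
    γ a * u                                  ≈⟨ *-distribʳ-⋁ (adm (a , refl)) proj₁ u ⟩
    ⋁Q (adm (a , refl)) (λ b → proj₁ b * u)  ≤⟨ ⋁-least (adm (a , refl)) _ _ proj₂ ⟩
    a * u                                    ∎

  γ-expansive : ∀ a → a ≤ γ a
  γ-expansive a = γ-greatest refl

  γ-*-≈ : ∀ a → γ a * u ≈Q a * u
  γ-*-≈ a = antisym (γ-*-≤ a) (*-mono (γ-expansive a) refl)

  γ-mono-* : ∀ {a b} → a * u ≤Q b * u → γ a ≤ γ b
  γ-mono-* {a} a*u≤b*u = γ-greatest (trans (γ-*-≤ a) a*u≤b*u)

  γ-cong-* : ∀ {a b} → a * u ≈Q b * u → γ a ≈ γ b
  γ-cong-* a*u≈b*u = A.antisym (γ-mono-* (reflexive a*u≈b*u))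
                               (γ-mono-* (reflexive (Eq.sym a*u≈b*u)))

  γ-+-sub : ∀ a b → γ a + γ b ≤ γ (a + b)
  γ-+-sub a b = γ-greatest (begin
    (γ a + γ b) * u          ≈⟨ *-distribʳ-+ (γ a) (γ b) u ⟩
    γ a * u +Q γ b * u       ≤⟨ +-mono (γ-*-≤ a) (γ-*-≤ b) ⟩
    a * u +Q b * u           ≈⟨ *-distribʳ-+ a b u ⟨
    (a + b) * u              ∎)

  γ-·-sub : ∀ a x → a · γ x ≤ γ (a · x)
  γ-·-sub a x = γ-greatest (begin
    (a · γ x) * u            ≈⟨ *-assoc a (γ x) u ⟩
    a * (γ x * u)            ≤⟨ *-mono A.refl (γ-*-≤ x) ⟩
    a * (x * u)              ≈⟨ *-assoc a x u ⟨
    (a · x) * u              ∎)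

  nucleus : StructuralNucleus M
  nucleus = record
    { γ          = γ
    ; mono       = λ a≤b → γ-mono-* (*-mono a≤b refl)
    ; expansive  = γ-expansive
    ; idempotent = λ a → γ-cong-* (γ-*-≈ a)
    ; +-sub      = γ-+-sub
    ; ·-sub      = γ-·-sub
    }

  module _ (generates : ∀ x → Σ Carrier (λ a → x ≈Q a * u)) where
    private
      coeff : QC → Carrier
      coeff x = proj₁ (generates x)

      coeff-* : ∀ x → x ≈Q coeff x * u
      coeff-* x = proj₂ (generates x)

      γ-coeff : ∀ {x a} → x ≈Q a * u → γ (coeff x) ≈ γ a
      γ-coeff {x} x≈a*u = γ-cong-* (Eq.trans (Eq.sym (coeff-* x)) x≈a*u)

      γ-coeff-* : ∀ x → γ (coeff x) * u ≈Q x
      γ-coeff-* x = Eq.trans (γ-*-≈ (coeff x)) (Eq.sym (coeff-* x))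

    ≅Aγ : Iso M (forget M Q) (Aγ M nucleus)
    ≅Aγ = record
      { to        = λ x → γ (coeff x) , coeff x , A.Eq.refl
      ; from      = λ y → proj₁ y * u
      ; to-cong   = λ {x} {y} x≈y → γ-coeff (Eq.trans x≈y (coeff-* y))
      ; from-cong = *-congˡ
      ; from∘to   = γ-coeff-*
      ; to∘from   = λ (c , b , c≈γb) →
                      A.Eq.trans (γ-coeff Eq.refl) (NucleusProperties.γ-fixed nucleus c≈γb)
      ; to-mono   = λ {x} {y} x≤y →
                      γ-mono-* (trans (reflexive (Eq.sym (coeff-* x))) (trans x≤y (reflexive (coeff-* y))))
      ; from-mono = λ c≤d → *-mono c≤d refl
      ; to-⋁      = λ p f → γ-coeff (begin-equality
          ⋁Q p f                              ≈⟨ ⋁-cong p (λ i → γ-coeff-* (f i)) ⟨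
          ⋁Q p (λ i → γ (coeff (f i)) * u)    ≈⟨ *-distribʳ-⋁ p (λ i → γ (coeff (f i))) u ⟨
          ⋁ p (λ i → γ (coeff (f i))) * u     ∎)
      ; to-+      = λ x y → γ-coeff (begin-equality
          x +Q y                                  ≈⟨ +-cong (γ-coeff-* x) (γ-coeff-* y) ⟨
          γ (coeff x) * u +Q γ (coeff y) * u      ≈⟨ *-distribʳ-+ (γ (coeff x)) (γ (coeff y)) u ⟨
          (γ (coeff x) + γ (coeff y)) * u         ∎)
      ; to-0      = γ-coeff (Eq.sym (*-zeroˡ u))
      ; to-*      = λ a x → γ-coeff (begin-equality
          a * x                   ≈⟨ *-congʳ (γ-coeff-* x) ⟨
          a * (γ (coeff x) * u)   ≈⟨ *-assoc a (γ (coeff x)) u ⟨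
          (a · γ (coeff x)) * u   ∎)
      }

module AγCyclic {s : Setting} {M : AQM s} (dg : DistributivelyGenerated M)
                (Q : Module M) (N : StructuralNucleus M)
                (iso : Iso M (forget M Q) (Aγ M N)) where
  open AQM M
  private module A = QuantaleProperties A
  open AQMProperties M
  open Module Q using (QC; _≈Q_; _*_)
  open ModuleProperties Q using (module Eq)
  open StructuralNucleus N
  open NucleusProperties N
  open Iso iso
  open PosetReasoning A.poset

  generator : QC
  generator = from (γ 1# , 1# , A.Eq.refl)

  γ-·-γ1 : ∀ c → γ (c · γ 1#) ≈ γ c
  γ-·-γ1 c = A.Eq.trans (γ-absorbʳ (Generated⇒·-monoʳ (dg c)) 1#)
                        (γ-cong (IsMonoid.identityʳ ·-isMonoid c))

  to-*-generator : ∀ x → proj₁ (to (proj₁ (to x) * generator)) ≈ proj₁ (to x)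
  to-*-generator x = begin-equality
    proj₁ (to (c * generator))     ≈⟨ to-* c generator ⟩
    γ (c · proj₁ (to generator))   ≈⟨ γ-cong (·-cong A.Eq.refl (to∘from _)) ⟩
    γ (c · γ 1#)                   ≈⟨ γ-·-γ1 c ⟩
    γ c                            ≈⟨ γ-fixed (proj₂ (proj₂ (to x))) ⟩
    c                              ∎
    where
      c : Carrier
      c = proj₁ (to x)

  generates : ∀ x → x ≈Q proj₁ (to x) * generator
  generates x = Eq.trans (Eq.sym (from∘to x))
                         (Eq.trans (from-cong (A.Eq.sym (to-*-generator x))) (from∘to _))

  cyclic : Cyclic M Q
  cyclic = generator , λ x → proj₁ (to x) , generates x

theorem6p7 : ∀ {s : Setting} (M : AQM s) → DistributivelyGenerated M →
    (Q : Module M) →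
    (Cyclic M Q ⇔ Σ (StructuralNucleus M) (λ γ → Iso M (forget M Q) (Aγ M γ)))
theorem6p7 M dg Q = mk⇔
  (λ (u , generates) → GeneratorNucleus.nucleus Q u , GeneratorNucleus.≅Aγ Q u generates)
  (λ (N , iso) → AγCyclic.cyclic dg Q N iso)
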